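{- Let $k$ be a field of characteristic different from $2$, let $r,a\in k$ and $D=4a+1$, and let $C^t\subset\mathbb{P}^3$ be an elliptic curve in twisted $\boldsymbol{\mu}_4$-normal form $$X_0^2 - DrX_2^2 = X_1X_3 - a(X_1-X_3)^2,\quad X_1^2-X_3^2 = X_0X_2,$$ with identity $(1:1:0:1)$. Then $C^t$ is isomorphic to the twisted Edwards curve $E$ with parameters $(-D,-16Dr)$, given in extended coordinates by $$X_0^2 - 16DrX_3^2 = -DX_1^2 + X_2^2,\quad X_0X_3 = X_1X_2,$$ via the isomorphism $C^t\to E$, $$(X_0:X_1:X_2:X_3)\longmapsto(4X_0:2(X_1-X_3):2(X_1+X_3):X_2),$$ with inverse $(X_0:X_1:X_2:X_3)\longmapsto(X_0:X_1+X_2:4X_3:-X_1+X_2)$.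
   Context: The twisted Edwards curve with parameters $(\alpha,\beta)$ (affine model $\alpha x^2+y^2=1+\beta x^2y^2$) is embedded in $\mathbb{P}^3$ by $(1:x:y:xy)$ as the curve $\alpha X_1^2+X_2^2 = X_0^2+\beta X_3^2,\ X_0X_3=X_1X_2$ ("extended coordinates"). -}

module Defs where

open import Level using (Level; _⊔_; suc)
open import Algebra.Bundles using (CommutativeRing)
open import Data.Product using (Σ; ∃; _×_; _,_)
open import Relation.Nullary using (¬_)

record Field (c ℓ : Level) : Set (suc (c ⊔ ℓ)) where
  field
    commutativeRing : CommutativeRing c ℓ
  open CommutativeRing commutativeRing public
  field
    1≉0     : ¬ (1# ≈ 0#)
    inverse : ∀ x → ¬ (x ≈ 0#) → ∃ λ y → x * y ≈ 1#

record Pt {c} (A : Set c) : Set c where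
  constructor ⟨_,_,_,_⟩
  field
    X0 X1 X2 X3 : A

module FieldDefs {c ℓ} (K : Field c ℓ) where
  open Field K

  two four sixteen : Carrier
  two = 1# + 1#
  four = two + two
  sixteen = four * four

  CharNot2 : Set ℓ
  CharNot2 = ¬ (two ≈ 0#)

  sq : Carrier → Carrier
  sq x = x * x

  -- a nonzero vector of k^4, i.e. a representative of a point of P^3
  NonZero : Pt Carrier → Set ℓ
  NonZero ⟨ x0 , x1 , x2 , x3 ⟩ =
    ¬ ((x0 ≈ 0#) × (x1 ≈ 0#) × (x2 ≈ 0#) × (x3 ≈ 0#))

  -- equality of points of P^3: P = t Q for a nonzero scalar t
  _∼_ : Pt Carrier → Pt Carrier → Set (c ⊔ ℓ)
  ⟨ x0 , x1 , x2 , x3 ⟩ ∼ ⟨ y0 , y1 , y2 , y3 ⟩ =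
    Σ Carrier λ t → ¬ (t ≈ 0#) ×
      ((x0 ≈ t * y0) × (x1 ≈ t * y1) × (x2 ≈ t * y2) × (x3 ≈ t * y3))

  Dof : Carrier → Carrier
  Dof a = four * a + 1#

  OnCt : (r a : Carrier) → Pt Carrier → Set ℓ
  OnCt r a P@(⟨ x0 , x1 , x2 , x3 ⟩) = NonZero P ×
    ((sq x0 - Dof a * r * sq x2 ≈ x1 * x3 - a * sq (x1 - x3)) ×
     (sq x1 - sq x3 ≈ x0 * x2))

  OnEdwards : (α β : Carrier) → Pt Carrier → Set ℓ
  OnEdwards α β P@(⟨ x0 , x1 , x2 , x3 ⟩) = NonZero P ×
    ((α * sq x1 + sq x2 ≈ sq x0 + β * sq x3) × (x0 * x3 ≈ x1 * x2))

  -- Smoothness of C^t (so that C^t is an elliptic curve): at every point the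
  -- Jacobian of (F , G) has rank 2, i.e. not all 2x2 minors vanish, where
  --   F = X0^2 - D r X2^2 - X1 X3 + a (X1 - X3)^2 ,  G = X1^2 - X3^2 - X0 X2 .
  gradF : (r a : Carrier) → Pt Carrier → Pt Carrier
  gradF r a ⟨ x0 , x1 , x2 , x3 ⟩ =
    ⟨ two * x0
    , - x3 + two * a * (x1 - x3)
    , - (two * Dof a * r * x2)
    , - x1 - two * a * (x1 - x3) ⟩

  gradG : Pt Carrier → Pt Carrier
  gradG ⟨ x0 , x1 , x2 , x3 ⟩ = ⟨ - x2 , two * x1 , - x0 , - (two * x3) ⟩

  minor : Carrier → Carrier → Carrier → Carrier → Carrier
  minor f g f' g' = f * g' - f' * g

  RankTwo : Pt Carrier → Pt Carrier → Set ℓ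
  RankTwo ⟨ f0 , f1 , f2 , f3 ⟩ ⟨ g0 , g1 , g2 , g3 ⟩ =
    ¬ ((minor f0 g0 f1 g1 ≈ 0#) × (minor f0 g0 f2 g2 ≈ 0#) ×
       (minor f0 g0 f3 g3 ≈ 0#) × (minor f1 g1 f2 g2 ≈ 0#) ×
       (minor f1 g1 f3 g3 ≈ 0#) × (minor f2 g2 f3 g3 ≈ 0#))

  SmoothCt : (r a : Carrier) → Set (c ⊔ ℓ)
  SmoothCt r a = ∀ P → OnCt r a P → RankTwo (gradF r a P) (gradG P)

  OCt : Pt Carrier
  OCt = ⟨ 1# , 1# , 0# , 1# ⟩

  OE : Pt Carrier
  OE = ⟨ 1# , 0# , 1# , 0# ⟩

  φ : Pt Carrier → Pt Carrier
  φ ⟨ x0 , x1 , x2 , x3 ⟩ = ⟨ four * x0 , two * (x1 - x3) , two * (x1 + x3) , x2 ⟩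

  ψ : Pt Carrier → Pt Carrier
  ψ ⟨ x0 , x1 , x2 , x3 ⟩ = ⟨ x0 , x1 + x2 , four * x3 , - x1 + x2 ⟩

-- φ and ψ are linear maps of k⁴ with ψ ∘ φ = φ ∘ ψ = 4 · id, so as 4 ≠ 0 they
-- are mutually inverse automorphisms of ℙ³. They exchange the two curves since
-- the two quadrics cutting out E pull back along φ to −16 and −4 times those
-- cutting out Cᵗ, and the latter pull back along ψ to −1 and −4 times the
-- former; these are polynomial identities over ℤ, checked by the ring solver.

module Submission where

open import Defs
open import Data.Product using (_×_; _,_)
open import Data.Nat.Base as ℕ using (ℕ; zero; suc)
import Data.Nat.Properties as ℕ
open import Data.Integer.Base as ℤ using (ℤ; -[1+_]; sign; ∣_∣; _◃_; _⊖_)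
import Data.Integer.Properties as ℤ
open import Data.Sign.Base as Sign using (Sign)
import Data.Maybe.Base as Maybe
open import Relation.Nullary using (¬_)
open import Relation.Nullary.Decidable.Core using (dec⇒maybe)
import Relation.Binary.PropositionalEquality as ≡
open import Algebra.Bundles using (CommutativeRing)
open import Algebra.Solver.Ring.AlmostCommutativeRing
  using (fromCommutativeRing; _-Raw-AlmostCommutative⟶_)

-- The ring solver over an arbitrary commutative ring, with integer
-- coefficients interpreted through the ring map ℤ → R.
module IntegerCoefficients {c ℓ} (R : CommutativeRing c ℓ) where
  open CommutativeRing R
  open import Algebra.Properties.Ring ring using (-‿involutive; -‿+-comm; -1*x≈-x; -0#≈0#)
  open import Algebra.Properties.CommutativeSemigroup +-commutativeSemigroup
    using () renaming (interchange to +-interchange)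
  open import Algebra.Properties.CommutativeSemigroup *-commutativeSemigroup
    using () renaming (interchange to *-interchange)
  open import Algebra.Properties.Semiring.Mult.TCOptimised semiring
    using (1+×; ×-homo-+; ×1-homo-*) renaming (_×_ to _·1_)
  open import Relation.Binary.Reasoning.Setoid setoid

  -- The optimised multiple makes ι 2 reduce to 1# + 1#, i.e. to two, so the
  -- solver's normal forms agree definitionally with the constants of Defs.
  ι : ℕ → Carrier
  ι n = n ·1 1#

  fromℤ : ℤ → Carrier
  fromℤ (ℤ.+ n)    = ι n
  fromℤ (-[1+ n ]) = - ι (suc n)

  fromSign : Sign → Carrier
  fromSign Sign.+ = 1#
  fromSign Sign.- = - 1#

  fromSign-homo-* : ∀ s t → fromSign (s Sign.* t) ≈ fromSign s * fromSign t
  fromSign-homo-* Sign.+ _      = sym (*-identityˡ _)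
  fromSign-homo-* Sign.- Sign.+ = sym (*-identityʳ _)
  fromSign-homo-* Sign.- Sign.- = sym (trans (-1*x≈-x (- 1#)) (-‿involutive 1#))

  fromℤ-◃ : ∀ s n → fromℤ (s ◃ n) ≈ fromSign s * ι n
  fromℤ-◃ _      zero    = sym (zeroʳ _)
  fromℤ-◃ Sign.+ (suc n) = sym (*-identityˡ _)
  fromℤ-◃ Sign.- (suc n) = sym (-1*x≈-x _)

  fromℤ-sign-abs : ∀ i → fromℤ i ≈ fromSign (sign i) * ι ∣ i ∣
  fromℤ-sign-abs i = trans (reflexive (≡.cong fromℤ (≡.sym (ℤ.◃-inverse i)))) (fromℤ-◃ (sign i) ∣ i ∣)

  fromℤ-⊖ : ∀ m n → fromℤ (m ⊖ n) ≈ ι m - ι n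
  fromℤ-⊖ m       zero    = sym (trans (+-congˡ -0#≈0#) (+-identityʳ (ι m)))
  fromℤ-⊖ zero    (suc n) = sym (+-identityˡ _)
  fromℤ-⊖ (suc m) (suc n) = begin
    fromℤ (suc m ⊖ suc n)             ≡⟨ ≡.cong fromℤ (ℤ.[1+m]⊖[1+n]≡m⊖n m n) ⟩
    fromℤ (m ⊖ n)                     ≈⟨ fromℤ-⊖ m n ⟩
    ι m - ι n                     ≈⟨ +-identityˡ _ ⟨
    0# + (ι m - ι n)              ≈⟨ +-congʳ (-‿inverseʳ 1#) ⟨
    (1# - 1#) + (ι m - ι n)       ≈⟨ +-interchange 1# (- 1#) (ι m) (- ι n) ⟩
    (1# + ι m) + (- 1# + - ι n)   ≈⟨ +-congˡ (-‿+-comm 1# (ι n)) ⟩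
    (1# + ι m) - (1# + ι n)       ≈⟨ +-cong (1+× m 1#) (-‿cong (1+× n 1#)) ⟨
    ι (suc m) - ι (suc n)         ∎

  fromℤ-homo-+ : ∀ i j → fromℤ (i ℤ.+ j) ≈ fromℤ i + fromℤ j
  fromℤ-homo-+ (ℤ.+ m)  (ℤ.+ n)  = ×-homo-+ 1# m n
  fromℤ-homo-+ (ℤ.+ m)  -[1+ n ] = fromℤ-⊖ m (suc n)
  fromℤ-homo-+ -[1+ m ] (ℤ.+ n)  = trans (fromℤ-⊖ n (suc m)) (+-comm (ι n) _)
  fromℤ-homo-+ -[1+ m ] -[1+ n ] = begin
    - ι (suc (suc (m ℕ.+ n)))       ≡⟨ ≡.cong (λ k → - ι (suc k)) (ℕ.+-suc m n) ⟨
    - ι (suc m ℕ.+ suc n)           ≈⟨ -‿cong (×-homo-+ 1# (suc m) (suc n)) ⟩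
    - (ι (suc m) + ι (suc n))       ≈⟨ -‿+-comm _ _ ⟨
    - ι (suc m) + - ι (suc n)       ∎

  fromℤ-homo-- : ∀ i → fromℤ (ℤ.- i) ≈ - fromℤ i
  fromℤ-homo-- (ℤ.+ zero)  = sym -0#≈0#
  fromℤ-homo-- ℤ.+[1+ n ]  = refl
  fromℤ-homo-- -[1+ n ]    = sym (-‿involutive _)

  fromℤ-homo-* : ∀ i j → fromℤ (i ℤ.* j) ≈ fromℤ i * fromℤ j
  fromℤ-homo-* i j = begin
    fromℤ ((sign i Sign.* sign j) ◃ (∣ i ∣ ℕ.* ∣ j ∣))
      ≈⟨ fromℤ-◃ (sign i Sign.* sign j) (∣ i ∣ ℕ.* ∣ j ∣) ⟩
    fromSign (sign i Sign.* sign j) * ι (∣ i ∣ ℕ.* ∣ j ∣)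
      ≈⟨ *-cong (fromSign-homo-* (sign i) (sign j)) (×1-homo-* ∣ i ∣ ∣ j ∣) ⟩
    (fromSign (sign i) * fromSign (sign j)) * (ι ∣ i ∣ * ι ∣ j ∣)
      ≈⟨ *-interchange _ _ _ _ ⟩
    (fromSign (sign i) * ι ∣ i ∣) * (fromSign (sign j) * ι ∣ j ∣)
      ≈⟨ *-cong (fromℤ-sign-abs i) (fromℤ-sign-abs j) ⟨
    fromℤ i * fromℤ j ∎

  fromℤ-homomorphism : ℤ.+-*-rawRing -Raw-AlmostCommutative⟶ fromCommutativeRing R
  fromℤ-homomorphism = record
    { ⟦_⟧    = fromℤ
    ; +-homo = fromℤ-homo-+
    ; *-homo = fromℤ-homo-*
    ; -‿homo = fromℤ-homo--
    ; 0-homo = refl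
    ; 1-homo = refl
    }

  open import Algebra.Solver.Ring ℤ.+-*-rawRing (fromCommutativeRing R) fromℤ-homomorphism
    (λ i j → Maybe.map (λ i≡j → reflexive (≡.cong fromℤ i≡j)) (dec⇒maybe (i ℤ.≟ j)))
    public

module TwistedMu4Edwards {c ℓ} (K : Field c ℓ) where
  open Field K
  open FieldDefs K
  open import Algebra.Properties.Ring ring using (x∙y⁻¹≈ε⇒x≈y; x≈y⇒x∙y⁻¹≈ε)
  open import Algebra.Properties.CommutativeSemigroup *-commutativeSemigroup using (xy∙z≈y∙xz)
  open IntegerCoefficients commutativeRing using (solve; _:=_; con; _:+_; _:*_; _:-_; :-_; Polynomial)
  open import Relation.Binary.Reasoning.Setoid setoid

  x*y≈0⇒y≈0 : ∀ {x y} → ¬ x ≈ 0# → x * y ≈ 0# → y ≈ 0#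
  x*y≈0⇒y≈0 {x} {y} x≉0 xy≈0 with inverse x x≉0
  ... | x⁻¹ , xx⁻¹≈1 = begin
    y                ≈⟨ *-identityˡ y ⟨
    1# * y           ≈⟨ *-congʳ xx⁻¹≈1 ⟨
    (x * x⁻¹) * y    ≈⟨ xy∙z≈y∙xz x x⁻¹ y ⟩
    x⁻¹ * (x * y)    ≈⟨ *-congˡ xy≈0 ⟩
    x⁻¹ * 0#         ≈⟨ zeroʳ x⁻¹ ⟩
    0#               ∎

  x≉0∧y≉0⇒x*y≉0 : ∀ {x y} → ¬ x ≈ 0# → ¬ y ≈ 0# → ¬ x * y ≈ 0#
  x≉0∧y≉0⇒x*y≉0 x≉0 y≉0 xy≈0 = y≉0 (x*y≈0⇒y≈0 x≉0 xy≈0)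

  x-y≈k*[u-v]⇒u≈v⇒x≈y : ∀ {x y k u v} → x - y ≈ k * (u - v) → u ≈ v → x ≈ y
  x-y≈k*[u-v]⇒u≈v⇒x≈y {x} {y} {k} {u} {v} x-y≈k[u-v] u≈v = x∙y⁻¹≈ε⇒x≈y x y (begin
    x - y          ≈⟨ x-y≈k[u-v] ⟩
    k * (u - v)    ≈⟨ *-congˡ (x≈y⇒x∙y⁻¹≈ε u≈v) ⟩
    k * 0#         ≈⟨ zeroʳ k ⟩
    0#             ∎)

  :zero :one :two :four :sixteen : ∀ {n} → Polynomial n
  :zero    = con (ℤ.+ 0)
  :one     = con (ℤ.+ 1)
  :two     = con (ℤ.+ 2)
  :four    = :two :+ :two
  :sixteen = :four :* :four

  four≈two*two : four ≈ two * two
  four≈two*two = solve 0 (:four := :two :* :two) refl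

  four≉0 : CharNot2 → ¬ four ≈ 0#
  four≉0 two≉0 four≈0 = x≉0∧y≉0⇒x*y≉0 two≉0 two≉0 (trans (sym four≈two*two) four≈0)

  IsZero : Pt Carrier → Set ℓ
  IsZero ⟨ x0 , x1 , x2 , x3 ⟩ = (x0 ≈ 0#) × (x1 ≈ 0#) × (x2 ≈ 0#) × (x3 ≈ 0#)

  _≋_⊙_ : Pt Carrier → Carrier → Pt Carrier → Set ℓ
  ⟨ x0 , x1 , x2 , x3 ⟩ ≋ t ⊙ ⟨ y0 , y1 , y2 , y3 ⟩ =
    (x0 ≈ t * y0) × (x1 ≈ t * y1) × (x2 ≈ t * y2) × (x3 ≈ t * y3)

  ≋⊙-cancel-zero : ∀ {t P Q} → ¬ t ≈ 0# → P ≋ t ⊙ Q → IsZero P → IsZero Q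
  ≋⊙-cancel-zero {t} t≉0 (e0 , e1 , e2 , e3) (z0 , z1 , z2 , z3) =
    cancel e0 z0 , cancel e1 z1 , cancel e2 z2 , cancel e3 z3
    where
    cancel : ∀ {x y} → x ≈ t * y → x ≈ 0# → y ≈ 0#
    cancel x≈ty x≈0 = x*y≈0⇒y≈0 t≉0 (trans (sym x≈ty) x≈0)

  ψ∘φ≋4⊙id : ∀ P → ψ (φ P) ≋ four ⊙ P
  ψ∘φ≋4⊙id ⟨ x0 , x1 , x2 , x3 ⟩ =
    refl ,
    solve 2 (λ x1 x3 → :two :* (x1 :- x3) :+ :two :* (x1 :+ x3) := :four :* x1) refl x1 x3 ,
    refl ,
    solve 2 (λ x1 x3 → (:- (:two :* (x1 :- x3))) :+ :two :* (x1 :+ x3) := :four :* x3) refl x1 x3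

  φ∘ψ≋4⊙id : ∀ Q → φ (ψ Q) ≋ four ⊙ Q
  φ∘ψ≋4⊙id ⟨ y0 , y1 , y2 , y3 ⟩ =
    refl ,
    solve 2 (λ y1 y2 → :two :* ((y1 :+ y2) :- ((:- y1) :+ y2)) := :four :* y1) refl y1 y2 ,
    solve 2 (λ y1 y2 → :two :* ((y1 :+ y2) :+ ((:- y1) :+ y2)) := :four :* y2) refl y1 y2 ,
    refl

  φ-OCt≋4⊙OE : φ OCt ≋ four ⊙ OE
  φ-OCt≋4⊙OE =
    refl ,
    solve 0 (:two :* (:one :- :one) := :four :* :zero) refl ,
    solve 0 (:two :* (:one :+ :one) := :four :* :one) refl ,
    solve 0 (:zero := :four :* :zero) refl

  φ-zero : ∀ P → IsZero P → IsZero (φ P)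
  φ-zero ⟨ x0 , x1 , x2 , x3 ⟩ (z0 , z1 , z2 , z3) =
    trans (*-congˡ z0) (zeroʳ four) ,
    trans (*-congˡ (+-cong z1 (-‿cong z3))) (solve 0 (:two :* (:zero :- :zero) := :zero) refl) ,
    trans (*-congˡ (+-cong z1 z3)) (solve 0 (:two :* (:zero :+ :zero) := :zero) refl) ,
    z2

  ψ-zero : ∀ Q → IsZero Q → IsZero (ψ Q)
  ψ-zero ⟨ y0 , y1 , y2 , y3 ⟩ (z0 , z1 , z2 , z3) =
    z0 ,
    trans (+-cong z1 z2) (+-identityʳ 0#) ,
    trans (*-congˡ z3) (zeroʳ four) ,
    trans (+-cong (-‿cong z1) z2) (solve 0 ((:- :zero) :+ :zero := :zero) refl)

  module _ (two≉0 : CharNot2) where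

    φ-nonzero : ∀ P → NonZero P → NonZero (φ P)
    φ-nonzero P P≉0 φP≈0 = P≉0 (≋⊙-cancel-zero (four≉0 two≉0) (ψ∘φ≋4⊙id P) (ψ-zero (φ P) φP≈0))

    ψ-nonzero : ∀ Q → NonZero Q → NonZero (ψ Q)
    ψ-nonzero Q Q≉0 ψQ≈0 = Q≉0 (≋⊙-cancel-zero (four≉0 two≉0) (φ∘ψ≋4⊙id Q) (φ-zero (ψ Q) ψQ≈0))

  Ct₁ : (r a : Carrier) → Pt Carrier → Carrier
  Ct₁ r a ⟨ x0 , x1 , x2 , x3 ⟩ = (sq x0 - Dof a * r * sq x2) - (x1 * x3 - a * sq (x1 - x3))

  Ct₂ : Pt Carrier → Carrier
  Ct₂ ⟨ x0 , x1 , x2 , x3 ⟩ = (sq x1 - sq x3) - x0 * x2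

  Ed₁ : (α β : Carrier) → Pt Carrier → Carrier
  Ed₁ α β ⟨ x0 , x1 , x2 , x3 ⟩ = (α * sq x1 + sq x2) - (sq x0 + β * sq x3)

  Ed₂ : Pt Carrier → Carrier
  Ed₂ ⟨ x0 , x1 , x2 , x3 ⟩ = x0 * x3 - x1 * x2

  module _ (r a : Carrier) where

    α β : Carrier
    α = - Dof a
    β = - (sixteen * Dof a * r)

    Ed₁∘φ≈-16*Ct₁ : ∀ P → Ed₁ α β (φ P) ≈ - sixteen * Ct₁ r a P
    Ed₁∘φ≈-16*Ct₁ ⟨ x0 , x1 , x2 , x3 ⟩ = solve 6
      (λ r a x0 x1 x2 x3 →
        let D = :four :* a :+ :one
            sq = λ x → x :* x
        in  ((:- D) :* sq (:two :* (x1 :- x3)) :+ sq (:two :* (x1 :+ x3)))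
              :- (sq (:four :* x0) :+ (:- (:sixteen :* D :* r)) :* sq x2)
            := (:- :sixteen) :* ((sq x0 :- D :* r :* sq x2) :- (x1 :* x3 :- a :* sq (x1 :- x3))))
      refl r a x0 x1 x2 x3

    Ed₂∘φ≈-4*Ct₂ : ∀ P → Ed₂ (φ P) ≈ - four * Ct₂ P
    Ed₂∘φ≈-4*Ct₂ ⟨ x0 , x1 , x2 , x3 ⟩ = solve 4
      (λ x0 x1 x2 x3 →
        (:four :* x0) :* x2 :- (:two :* (x1 :- x3)) :* (:two :* (x1 :+ x3))
        := (:- :four) :* ((x1 :* x1 :- x3 :* x3) :- x0 :* x2))
      refl x0 x1 x2 x3

    Ct₁∘ψ≈-Ed₁ : ∀ Q → Ct₁ r a (ψ Q) ≈ - 1# * Ed₁ α β Q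
    Ct₁∘ψ≈-Ed₁ ⟨ y0 , y1 , y2 , y3 ⟩ = solve 6
      (λ r a y0 y1 y2 y3 →
        let D = :four :* a :+ :one
            sq = λ x → x :* x
            u = y1 :+ y2
            w = (:- y1) :+ y2
        in  (sq y0 :- D :* r :* sq (:four :* y3)) :- (u :* w :- a :* sq (u :- w))
            := (:- :one) :* (((:- D) :* sq y1 :+ sq y2) :- (sq y0 :+ (:- (:sixteen :* D :* r)) :* sq y3)))
      refl r a y0 y1 y2 y3

    Ct₂∘ψ≈-4*Ed₂ : ∀ Q → Ct₂ (ψ Q) ≈ - four * Ed₂ Q
    Ct₂∘ψ≈-4*Ed₂ ⟨ y0 , y1 , y2 , y3 ⟩ = solve 4
      (λ y0 y1 y2 y3 →
        let u = y1 :+ y2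
            w = (:- y1) :+ y2
        in  (u :* u :- w :* w) :- y0 :* (:four :* y3) := (:- :four) :* (y0 :* y3 :- y1 :* y2))
      refl y0 y1 y2 y3

    OCt-on-Ct : OnCt r a OCt
    OCt-on-Ct =
      (λ (1≈0 , _) → 1≉0 1≈0) ,
      solve 2 (λ r a → :one :* :one :- (:four :* a :+ :one) :* r :* (:zero :* :zero)
                       := :one :* :one :- a :* ((:one :- :one) :* (:one :- :one))) refl r a ,
      solve 0 (:one :* :one :- :one :* :one := :one :* :zero) refl

    OE-on-Ed : OnEdwards α β OE
    OE-on-Ed =
      (λ (1≈0 , _) → 1≉0 1≈0) ,
      solve 2 (λ r a → let D = :four :* a :+ :one in
                       (:- D) :* (:zero :* :zero) :+ :one :* :one
                       := :one :* :one :+ (:- (:sixteen :* D :* r)) :* (:zero :* :zero)) refl r a ,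
      solve 0 (:one :* :zero := :zero :* :one) refl

    module _ (two≉0 : CharNot2) where

      φ-Ct⇒Ed : ∀ P → OnCt r a P → OnEdwards α β (φ P)
      φ-Ct⇒Ed P (P≉0 , eq₁ , eq₂) =
        φ-nonzero two≉0 P P≉0 ,
        x-y≈k*[u-v]⇒u≈v⇒x≈y (Ed₁∘φ≈-16*Ct₁ P) eq₁ ,
        x-y≈k*[u-v]⇒u≈v⇒x≈y (Ed₂∘φ≈-4*Ct₂ P) eq₂

      ψ-Ed⇒Ct : ∀ Q → OnEdwards α β Q → OnCt r a (ψ Q)
      ψ-Ed⇒Ct Q (Q≉0 , eq₁ , eq₂) =
        ψ-nonzero two≉0 Q Q≉0 ,
        x-y≈k*[u-v]⇒u≈v⇒x≈y (Ct₁∘ψ≈-Ed₁ Q) eq₁ ,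
        x-y≈k*[u-v]⇒u≈v⇒x≈y (Ct₂∘ψ≈-4*Ed₂ Q) eq₂

mainTheorem2 : ∀ {c ℓ} (K : Field c ℓ) →
    let open Field K
        open FieldDefs K
    in CharNot2 → (r a : Carrier) → SmoothCt r a →
       let D = Dof a
           α = - D
           β = - (sixteen * D * r)
       in OnCt r a OCt ×
          OnEdwards α β OE ×
          (∀ P → OnCt r a P → OnEdwards α β (φ P)) ×
          (∀ Q → OnEdwards α β Q → OnCt r a (ψ Q)) ×
          (∀ P → OnCt r a P → ψ (φ P) ∼ P) ×
          (∀ Q → OnEdwards α β Q → φ (ψ Q) ∼ Q) ×
          (φ OCt ∼ OE)
mainTheorem2 K two≉0 r a _ =
  OCt-on-Ct r a ,
  OE-on-Ed r a ,
  φ-Ct⇒Ed r a two≉0 ,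
  ψ-Ed⇒Ct r a two≉0 ,
  (λ P _ → four , four≉0 two≉0 , ψ∘φ≋4⊙id P) ,
  (λ Q _ → four , four≉0 two≉0 , φ∘ψ≋4⊙id Q) ,
  (four , four≉0 two≉0 , φ-OCt≋4⊙OE)
  where
  open FieldDefs K using (four)
  open TwistedMu4Edwards K
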